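{- Let $T$ be a total complete minimum broadcast tree of order $k$ ($tcmbt_k$), $k\geq 1$. Then $Tr_t(T)=k$ and $Tr(T)=k+1$.
   Context: The total complete minimum broadcast tree of order $k$, $tcmbt_k$, is defined recursively: $tcmbt_1$ is a rooted tree consisting of a root of degree $1$ adjacent to a single vertex of degree $1$ (a path on two vertices rooted at an end). For $k\geq 2$, $tcmbt_k$ is a rooted tree whose root has degree $k$ and is adjacent to vertices $v_1,\dots,v_k$, where for each $1\leq i\leq k-1$, $v_i$ is the root of a copy of $tcmbt_i$ (with these copies pairwise disjoint), and $v_k$ is additionally adjacent to vertices $u_1,\dots,u_{k-1}$, where each $u_i$ is the root of a (further disjoint) copy of $tcmbt_i$. A transitive partition of order $k$ of a graph $G=(V,E)$ is a partition $\{V_1,\dots,V_k\}$ of $V$ into nonempty sets such that for all $1\leq i<j\leq k$, every vertex of $V_j$ has a neighbour in $V_i$; $Tr(G)$ is the maximum order of a transitive partition. A total transitive partition of order $k$ is such a partition satisfying moreover that for all $1\leq i\leq j\leq k$ every vertex of $V_j$ has a neighbour in $V_i$ (for $i=j$: every vertex of $V_i$ is adjacent to another vertex of $V_i$); $Tr_t(G)$ is the maximum order of a total transitive partition. -}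

module Defs where

open import Data.Nat using (ℕ; zero; suc; _+_; _≤_; _<_)
open import Data.Fin using (Fin; toℕ)
open import Data.List using (List; []; _∷_; _++_; _∷ʳ_)
open import Data.List.Membership.Propositional using (_∈_)
open import Data.Product using (Σ; ∃; _×_; _,_)
open import Data.Sum using (_⊎_)
open import Relation.Binary.PropositionalEquality using (_≡_)

data Tree : Set where
  node : List Tree → Tree

-- For k = 0 this gives tcmbt 1 = a root with
-- a single leaf child, matching the base case of the paper.
-- tcmbt 0 (a single vertex) is an unused placeholder.
mutual
  tcmbt : ℕ → Tree
  tcmbt zero    = node []
  tcmbt (suc k) = node (below k ∷ʳ node (below k))

  below : ℕ → List Tree
  below zero    = []
  below (suc k) = below k ∷ʳ tcmbt (suc k)

mutual
  size : Tree → ℕ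
  size (node ts) = suc (sizes ts)

  sizes : List Tree → ℕ
  sizes []       = 0
  sizes (t ∷ ts) = size t + sizes ts

-- Edges in preorder numbering: the root of a tree numbered from offset o
-- gets number o; its subtrees are numbered consecutively after it.
mutual
  edges : ℕ → Tree → List (ℕ × ℕ)
  edges o (node ts) = edgesL o (suc o) ts

  -- edgesL p o ts : edges from parent p to the roots of ts (numbered from o),
  -- together with the edges inside ts.
  edgesL : ℕ → ℕ → List Tree → List (ℕ × ℕ)
  edgesL p o []       = []
  edgesL p o (t ∷ ts) = (p , o) ∷ (edges o t ++ edgesL p (o + size t) ts)

record Graph : Set₁ where
  field
    n   : ℕ
    Adj : Fin n → Fin n → Set
open Graph public

treeGraph : Tree → Graph
treeGraph t = record
  { n   = size t
  ; Adj = λ u v → ((toℕ u , toℕ v) ∈ edges 0 t) ⊎ ((toℕ v , toℕ u) ∈ edges 0 t)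
  }

-- A transitive partition of order k: c v = i means v ∈ V_{i+1}.
-- Every class nonempty; for i < j every vertex of V_j has a neighbour in V_i.
IsTransitivePartition : (G : Graph) (k : ℕ) → (Fin (n G) → Fin k) → Set
IsTransitivePartition G k c =
  ((i : Fin k) → ∃ λ v → c v ≡ i) ×
  ((v : Fin (n G)) (i : Fin k) → toℕ i < toℕ (c v) →
     ∃ λ u → Adj G v u × c u ≡ i)

IsTotalTransitivePartition : (G : Graph) (k : ℕ) → (Fin (n G) → Fin k) → Set
IsTotalTransitivePartition G k c =
  ((i : Fin k) → ∃ λ v → c v ≡ i) ×
  ((v : Fin (n G)) (i : Fin k) → toℕ i ≤ toℕ (c v) →
     ∃ λ u → Adj G v u × c u ≡ i)

HasTransitivePartition : Graph → ℕ → Set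
HasTransitivePartition G k = ∃ λ c → IsTransitivePartition G k c

HasTotalTransitivePartition : Graph → ℕ → Set
HasTotalTransitivePartition G k = ∃ λ c → IsTotalTransitivePartition G k c

TrEq : Graph → ℕ → Set
TrEq G k = HasTransitivePartition G k × (∀ m → HasTransitivePartition G m → m ≤ k)

TrtEq : Graph → ℕ → Set
TrtEq G k = HasTotalTransitivePartition G k × (∀ m → HasTotalTransitivePartition G m → m ≤ k)

{-# OPTIONS --safe #-}
-- Every vertex of tcmbt k has at most k neighbours.  A vertex in the last class of a total
-- (ordinary) transitive partition of order m has neighbours in m (m - 1) distinct classes,
-- so Trₜ ≤ k and Tr ≤ k + 1.  Conversely, putting the root of every copy of tcmbt j in class
-- j and v_k in class k gives a total transitive partition of order k, and putting the root of
-- every copy of tcmbt j in class j + 1 and v_k in class 1 gives a transitive partition of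
-- order k + 1: in both colourings each vertex finds the classes it needs among its parent
-- and its children.
module Submission where

open import Defs
open import Data.Nat using (ℕ; zero; suc; _+_; _≤_; _<_; z≤n; s≤s; s≤s⁻¹; z<s; _≟_; _<?_)
open import Data.Nat.Properties
open import Data.Fin as Fin using (Fin; toℕ; fromℕ; fromℕ<; inject₁)
open import Data.Fin.Properties
  using (toℕ-injective; toℕ-fromℕ; toℕ-fromℕ<; toℕ<n; toℕ≤pred[n]; toℕ-inject₁; inject₁-injective;
         injective⇒≤)
open import Data.List using (List; []; _∷_; _++_; _∷ʳ_; length; lookup; concatMap)
open import Data.List.Properties using (length-++; concatMap-++)
open import Data.List.Membership.Propositional using (_∈_)
open import Data.List.Relation.Binary.Subset.Propositional using (_⊆_)
open import Data.List.Relation.Unary.Any as Any using (Any; here; there)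
open import Data.List.Relation.Unary.Any.Properties using (++⁺ˡ; ++⁺ʳ; ++⁻; lookup-index)
open import Data.List.Relation.Unary.All using (All; []; _∷_)
open import Data.List.Relation.Unary.All.Properties using () renaming (++⁺ to All-++⁺)
open import Data.Maybe using (Maybe; just; nothing)
open import Data.Product as Product using (Σ; ∃; _×_; _,_; proj₁; proj₂)
open import Data.Sum as Sum using (_⊎_; inj₁; inj₂)
open import Function using (_∘_; id)
open import Function.Definitions using (Injective)
open import Relation.Nullary using (¬_; yes; no; contradiction)
open import Relation.Binary.PropositionalEquality

-- Preorder numbering of trees

_∈[_,+_⟩ : ℕ → ℕ → ℕ → Set
x ∈[ o ,+ s ⟩ = o ≤ x × x < o + s

∈[,+⟩-weakenʳ : ∀ {o s s′ x} → x ∈[ o ,+ s ⟩ → x ∈[ o ,+ s + s′ ⟩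
∈[,+⟩-weakenʳ {o} {s} {s′} (o≤x , x<o+s) = o≤x , <-≤-trans x<o+s (+-monoʳ-≤ o (m≤m+n s s′))

∈[,+⟩-shift : ∀ {o s s′ x} → x ∈[ o + s ,+ s′ ⟩ → x ∈[ o ,+ s + s′ ⟩
∈[,+⟩-shift {o} {s} {s′} {x} (o+s≤x , x<o+s+s′) =
  ≤-trans (m≤m+n o s) o+s≤x , subst (x <_) (+-assoc o s s′) x<o+s+s′

∈[,+⟩-unshift : ∀ {o s s′ x} → o + s ≤ x → x ∈[ o ,+ s + s′ ⟩ → x ∈[ o + s ,+ s′ ⟩
∈[,+⟩-unshift {o} {s} {s′} {x} o+s≤x (_ , x<o+[s+s′]) =
  o+s≤x , subst (x <_) (sym (+-assoc o s s′)) x<o+[s+s′]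

∈[,+⟩-suc : ∀ {o s x} → x ∈[ suc o ,+ s ⟩ → x ∈[ o ,+ suc s ⟩
∈[,+⟩-suc {o} {s} {x} (o<x , x<1+o+s) = <⇒≤ o<x , subst (x <_) (sym (+-suc o s)) x<1+o+s

∈[,+⟩-unsuc : ∀ {o s x} → x ≢ o → x ∈[ o ,+ suc s ⟩ → x ∈[ suc o ,+ s ⟩
∈[,+⟩-unsuc {o} {s} {x} x≢o (o≤x , x<o+1+s) = ≤∧≢⇒< o≤x (x≢o ∘ sym) , subst (x <_) (+-suc o s) x<o+1+s

∉[,+0⟩ : ∀ {o x} → ¬ x ∈[ o ,+ 0 ⟩
∉[,+0⟩ {o} {x} (o≤x , x<o+0) = <⇒≱ (subst (x <_) (+-identityʳ o) x<o+0) o≤x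

size>0 : ∀ t → 0 < size t
size>0 (node _) = z<s

root∈[,+⟩ : ∀ o t → o ∈[ o ,+ size t ⟩
root∈[,+⟩ o t = ≤-refl , m<m+n o (size>0 t)

mutual
  edges-within : ∀ o t {a b} → (a , b) ∈ edges o t → a ∈[ o ,+ size t ⟩ × b ∈[ o ,+ size t ⟩
  edges-within o (node ts) e with edgesL-within o (suc o) ts e
  ... | inj₁ refl , b∈ = root∈[,+⟩ o (node ts) , ∈[,+⟩-suc b∈
  ... | inj₂ a∈   , b∈ = ∈[,+⟩-suc a∈ , ∈[,+⟩-suc b∈

  edgesL-within : ∀ p o ts {a b} → (a , b) ∈ edgesL p o ts →
    (a ≡ p ⊎ a ∈[ o ,+ sizes ts ⟩) × b ∈[ o ,+ sizes ts ⟩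
  edgesL-within p o (t ∷ ts) (here refl) = inj₁ refl , ∈[,+⟩-weakenʳ (root∈[,+⟩ o t)
  edgesL-within p o (t ∷ ts) (there e) with ++⁻ (edges o t) e
  ... | inj₁ e′ with edges-within o t e′
  ...   | a∈ , b∈ = inj₂ (∈[,+⟩-weakenʳ a∈) , ∈[,+⟩-weakenʳ b∈
  edgesL-within p o (t ∷ ts) (there e) | inj₂ e′ with edgesL-within p (o + size t) ts e′
  ...   | a≡p⊎a∈ , b∈ = Sum.map₂ ∈[,+⟩-shift a≡p⊎a∈ , ∈[,+⟩-shift b∈

edges⊆edgesL-head : ∀ p o t ts → edges o t ⊆ edgesL p o (t ∷ ts)
edges⊆edgesL-head p o t ts = there ∘ ++⁺ˡ

edgesL-tail⊆edgesL : ∀ p o t ts → edgesL p (o + size t) ts ⊆ edgesL p o (t ∷ ts)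
edgesL-tail⊆edgesL p o t ts = there ∘ ++⁺ʳ (edges o t)

-- Neighbours and degrees

Adjacent : List (ℕ × ℕ) → ℕ → ℕ → Set
Adjacent E x u = (x , u) ∈ E ⊎ (u , x) ∈ E

Adjacent-mono : ∀ {E F x u} → E ⊆ F → Adjacent E x u → Adjacent F x u
Adjacent-mono E⊆F = Sum.map E⊆F E⊆F

otherEnd : ℕ → ℕ × ℕ → List ℕ
otherEnd x (a , b) with a ≟ x | b ≟ x
... | yes _ | _     = b ∷ []
... | no _  | yes _ = a ∷ []
... | no _  | no _  = []

neighbours : ℕ → List (ℕ × ℕ) → List ℕ
neighbours x = concatMap (otherEnd x)

degree : ℕ → List (ℕ × ℕ) → ℕ
degree x E = length (neighbours x E)

otherEnd-source : ∀ a b → otherEnd a (a , b) ≡ b ∷ []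
otherEnd-source a b with a ≟ a
... | yes _   = refl
... | no a≢a = contradiction refl a≢a

otherEnd-target : ∀ {a b} → a ≢ b → otherEnd b (a , b) ≡ a ∷ []
otherEnd-target {a} {b} a≢b with a ≟ b | b ≟ b
... | yes a≡b | _       = contradiction a≡b a≢b
... | no _    | yes _   = refl
... | no _    | no b≢b = contradiction refl b≢b

otherEnd-apart : ∀ {a b x} → a ≢ x → b ≢ x → otherEnd x (a , b) ≡ []
otherEnd-apart {a} {b} {x} a≢x b≢x with a ≟ x | b ≟ x
... | yes a≡x | _       = contradiction a≡x a≢x
... | no _    | yes b≡x = contradiction b≡x b≢x
... | no _    | no _    = refl

∈otherEnd-target : ∀ x u → u ∈ otherEnd x (u , x)
∈otherEnd-target x u with u ≟ x | x ≟ x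
... | yes u≡x | _       = here u≡x
... | no _    | yes _   = here refl
... | no _    | no x≢x = contradiction refl x≢x

Adjacent⇒∈neighbours : ∀ E {x u} → Adjacent E x u → u ∈ neighbours x E
Adjacent⇒∈neighbours (_ ∷ _) {x} {u} (inj₁ (here refl)) =
  ++⁺ˡ (subst (u ∈_) (sym (otherEnd-source x u)) (here refl))
Adjacent⇒∈neighbours (_ ∷ _) {x} {u} (inj₂ (here refl)) = ++⁺ˡ (∈otherEnd-target x u)
Adjacent⇒∈neighbours (e ∷ E) {x} (inj₁ (there x→u)) =
  ++⁺ʳ (otherEnd x e) (Adjacent⇒∈neighbours E (inj₁ x→u))
Adjacent⇒∈neighbours (e ∷ E) {x} (inj₂ (there u→x)) =
  ++⁺ʳ (otherEnd x e) (Adjacent⇒∈neighbours E (inj₂ u→x))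

neighbours-apart : ∀ {x} E → (∀ {a b} → (a , b) ∈ E → a ≢ x × b ≢ x) → neighbours x E ≡ []
neighbours-apart []            _     = refl
neighbours-apart ((a , b) ∷ E) apart =
  cong₂ _++_ (otherEnd-apart a≢x b≢x) (neighbours-apart E (apart ∘ there))
  where
  a≢x = proj₁ (apart (here refl))
  b≢x = proj₂ (apart (here refl))

degree-++ : ∀ x E F → degree x (E ++ F) ≡ degree x E + degree x F
degree-++ x E F = trans (cong length (concatMap-++ (otherEnd x) E F)) (length-++ (neighbours x E))

degree-edges-outside : ∀ o t {x} → ¬ x ∈[ o ,+ size t ⟩ → degree x (edges o t) ≡ 0
degree-edges-outside o t {x} x∉ =
  cong length (neighbours-apart (edges o t) λ e → Product.map avoid avoid (edges-within o t e))
  where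
  avoid : ∀ {y} → y ∈[ o ,+ size t ⟩ → y ≢ x
  avoid y∈ refl = x∉ y∈

degree-edgesL-outside : ∀ p o ts {x} → x ≢ p → ¬ x ∈[ o ,+ sizes ts ⟩ → degree x (edgesL p o ts) ≡ 0
degree-edgesL-outside p o ts {x} x≢p x∉ =
  cong length (neighbours-apart (edgesL p o ts) λ e → Product.map avoid′ avoid (edgesL-within p o ts e))
  where
  avoid : ∀ {y} → y ∈[ o ,+ sizes ts ⟩ → y ≢ x
  avoid y∈ refl = x∉ y∈
  avoid′ : ∀ {y} → y ≡ p ⊎ y ∈[ o ,+ sizes ts ⟩ → y ≢ x
  avoid′ (inj₁ refl) refl = x≢p refl
  avoid′ (inj₂ y∈)      = avoid y∈

degree-edgesL-∷ : ∀ x p o t ts → degree x (edgesL p o (t ∷ ts)) ≡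
  length (otherEnd x (p , o)) + (degree x (edges o t) + degree x (edgesL p (o + size t) ts))
degree-edgesL-∷ x p o t ts =
  trans (length-++ (otherEnd x (p , o))) (cong (length (otherEnd x (p , o)) +_) (degree-++ x (edges o t) _))

degree-edgesL-parent : ∀ p o ts → p < o → degree p (edgesL p o ts) ≡ length ts
degree-edgesL-parent p o []       _   = refl
degree-edgesL-parent p o (t ∷ ts) p<o = begin
  degree p (edgesL p o (t ∷ ts))
    ≡⟨ degree-edgesL-∷ p p o t ts ⟩
  length (otherEnd p (p , o)) + (degree p (edges o t) + degree p (edgesL p (o + size t) ts))
    ≡⟨ cong₂ (λ ends rest → length ends + (degree p (edges o t) + rest))
         (otherEnd-source p o)
         (degree-edgesL-parent p (o + size t) ts (<-≤-trans p<o (m≤m+n o (size t)))) ⟩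
  suc (degree p (edges o t) + length ts)
    ≡⟨ cong (λ d → suc (d + length ts)) (degree-edges-outside o t (λ (o≤p , _) → <⇒≱ p<o o≤p)) ⟩
  suc (length ts) ∎
  where open ≡-Reasoning

data Branching≤ (b : ℕ) : Tree → Set where
  node : ∀ {ts} → length ts ≤ b → All (Branching≤ b) ts → Branching≤ b (node ts)

degree-edges-root : ∀ {b} o t → Branching≤ b t → degree o (edges o t) ≤ b
degree-edges-root o (node ts) (node ts≤b _) =
  ≤-trans (≤-reflexive (degree-edgesL-parent o (suc o) ts ≤-refl)) ts≤b

degree-edgesL-∷-≤ : ∀ x p o t ts {e d d′} → length (otherEnd x (p , o)) ≡ e →
  degree x (edges o t) ≤ d → degree x (edgesL p (o + size t) ts) ≤ d′ →
  degree x (edgesL p o (t ∷ ts)) ≤ e + (d + d′)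
degree-edgesL-∷-≤ x p o t ts ends≡e head≤d tail≤d′ =
  ≤-trans (≤-reflexive (degree-edgesL-∷ x p o t ts)) (+-mono-≤ (≤-reflexive ends≡e) (+-mono-≤ head≤d tail≤d′))

mutual
  degree-edges-nonroot : ∀ {b} o t → Branching≤ b t → ∀ {x} → x ≢ o → degree x (edges o t) ≤ suc b
  degree-edges-nonroot o (node ts) (node _ bts) = degree-edgesL-nonparent o (suc o) ts bts

  degree-edgesL-nonparent : ∀ {b} p o ts → All (Branching≤ b) ts →
    ∀ {x} → x ≢ p → degree x (edgesL p o ts) ≤ suc b
  degree-edgesL-nonparent p o []       []          _   = z≤n
  degree-edgesL-nonparent {b} p o (t ∷ ts) (bt ∷ bts) {x} x≢p with x ≟ o
  ... | yes refl = ≤-trans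
    (degree-edgesL-∷-≤ x p o t ts (cong length (otherEnd-target (x≢p ∘ sym)))
      (degree-edges-root o t bt)
      (≤-reflexive (degree-edgesL-outside p (o + size t) ts x≢p
        λ (o+t≤o , _) → <⇒≱ (m<m+n o (size>0 t)) o+t≤o)))
    (≤-reflexive (cong suc (+-identityʳ b)))
  ... | no x≢o with x <? o + size t
  ...   | yes x<o+t = ≤-trans
    (degree-edgesL-∷-≤ x p o t ts (cong length (otherEnd-apart (x≢p ∘ sym) (x≢o ∘ sym)))
      (degree-edges-nonroot o t bt x≢o)
      (≤-reflexive (degree-edgesL-outside p (o + size t) ts x≢p λ (o+t≤x , _) → <⇒≱ x<o+t o+t≤x)))
    (≤-reflexive (+-identityʳ (suc b)))
  ...   | no x≮o+t =
    degree-edgesL-∷-≤ x p o t ts (cong length (otherEnd-apart (x≢p ∘ sym) (x≢o ∘ sym)))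
      (≤-reflexive (degree-edges-outside o t λ (_ , x<o+t) → x≮o+t x<o+t))
      (degree-edgesL-nonparent p (o + size t) ts bts x≢p)

length-∷ʳ : ∀ {A : Set} (xs : List A) y → length (xs ∷ʳ y) ≡ suc (length xs)
length-∷ʳ xs y = trans (length-++ xs) (+-comm (length xs) 1)

length-below : ∀ k → length (below k) ≡ k
length-below zero    = refl
length-below (suc k) = trans (length-∷ʳ (below k) (tcmbt (suc k))) (cong suc (length-below k))

mutual
  tcmbt-branching : ∀ {b} k → k ≤ b → Branching≤ b (tcmbt k)
  tcmbt-branching zero    _   = node z≤n []
  tcmbt-branching (suc k) k<b =
    node (≤-trans (≤-reflexive (trans (length-∷ʳ (below k) _) (cong suc (length-below k)))) k<b)
         (tcmbt-children-branching k (<⇒≤ k<b))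

  tcmbt-children-branching : ∀ {b} k → k ≤ b → All (Branching≤ b) (below k ∷ʳ node (below k))
  tcmbt-children-branching k k≤b =
    All-++⁺ (below-branching k k≤b) (node (≤-trans (≤-reflexive (length-below k)) k≤b) (below-branching k k≤b) ∷ [])

  below-branching : ∀ {b} k → k ≤ b → All (Branching≤ b) (below k)
  below-branching zero    _   = []
  below-branching (suc k) k<b = All-++⁺ (below-branching k (<⇒≤ k<b)) (tcmbt-branching (suc k) k<b ∷ [])

tcmbt-degree≤ : ∀ k x → degree x (edges 0 (tcmbt (suc k))) ≤ suc k
tcmbt-degree≤ k x with x ≟ 0
... | yes refl = degree-edges-root 0 (tcmbt (suc k)) (tcmbt-branching (suc k) ≤-refl)
... | no x≢0   =
  degree-edgesL-nonparent 0 1 (below k ∷ʳ node (below k)) (tcmbt-children-branching k ≤-refl) x≢0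

-- Upper bounds from the maximum degree

-- Neighbours are listed by their numbers toℕ u, as in the edge lists of trees.
MaxDegree≤ : Graph → ℕ → Set
MaxDegree≤ G Δ = ∀ v → Σ (List ℕ) λ ns → length ns ≤ Δ × (∀ u → Adj G v u → toℕ u ∈ ns)

treeGraph-maxDegree≤ : ∀ t {Δ} → (∀ x → degree x (edges 0 t) ≤ Δ) → MaxDegree≤ (treeGraph t) Δ
treeGraph-maxDegree≤ t degree≤Δ v =
  neighbours (toℕ v) (edges 0 t) , degree≤Δ (toℕ v) , λ u → Adjacent⇒∈neighbours (edges 0 t)

tcmbt-maxDegree≤ : ∀ k → MaxDegree≤ (treeGraph (tcmbt (suc k))) (suc k)
tcmbt-maxDegree≤ k = treeGraph-maxDegree≤ (tcmbt (suc k)) (tcmbt-degree≤ k)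

injection⇒≤length : ∀ {a} {A : Set a} {m} {xs : List A} (g : Fin m → A) →
  (∀ i → g i ∈ xs) → Injective _≡_ _≡_ g → m ≤ length xs
injection⇒≤length {xs = xs} g g∈xs g-injective =
  injective⇒≤ {f = Any.index ∘ g∈xs} λ {i} {j} same-index → g-injective (begin
    g i                            ≡⟨ lookup-index (g∈xs i) ⟩
    lookup xs (Any.index (g∈xs i)) ≡⟨ cong (lookup xs) same-index ⟩
    lookup xs (Any.index (g∈xs j)) ≡⟨ lookup-index (g∈xs j) ⟨
    g j                            ∎)
  where open ≡-Reasoning

neighbourClasses≤maxDegree : ∀ {G Δ k m} → MaxDegree≤ G Δ → (c : Fin (n G) → Fin k) (v : Fin (n G))
  (f : Fin m → Fin k) → Injective _≡_ _≡_ f → (∀ i → ∃ λ u → Adj G v u × c u ≡ f i) → m ≤ Δ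
neighbourClasses≤maxDegree maxDegree c v f f-injective sees with maxDegree v
... | ns , ns≤Δ , adj⇒∈ns = ≤-trans (injection⇒≤length g g∈ns g-injective) ns≤Δ
  where
  g : _ → ℕ
  g i = toℕ (proj₁ (sees i))
  g∈ns : ∀ i → g i ∈ ns
  g∈ns i = adj⇒∈ns _ (proj₁ (proj₂ (sees i)))
  g-injective : Injective _≡_ _≡_ g
  g-injective {i} {j} gi≡gj =
    f-injective (trans (sym (proj₂ (proj₂ (sees i)))) (trans (cong c (toℕ-injective gi≡gj)) (proj₂ (proj₂ (sees j)))))

totalTransitive≤maxDegree : ∀ {G Δ} → MaxDegree≤ G Δ → ∀ m → HasTotalTransitivePartition G m → m ≤ Δ
totalTransitive≤maxDegree maxDegree zero    _                      = z≤n
totalTransitive≤maxDegree maxDegree (suc m) (c , nonempty , sees) with nonempty (fromℕ m)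
... | v , cv≡last = neighbourClasses≤maxDegree maxDegree c v id id λ i → sees v i (i≤cv i)
  where
  i≤cv : ∀ i → toℕ i ≤ toℕ (c v)
  i≤cv i = subst (toℕ i ≤_) (sym (trans (cong toℕ cv≡last) (toℕ-fromℕ m))) (toℕ≤pred[n] i)

transitive≤1+maxDegree : ∀ {G Δ} → MaxDegree≤ G Δ → ∀ m → HasTransitivePartition G m → m ≤ suc Δ
transitive≤1+maxDegree maxDegree zero    _                      = z≤n
transitive≤1+maxDegree maxDegree (suc m) (c , nonempty , sees) with nonempty (fromℕ m)
... | v , cv≡last =
  s≤s (neighbourClasses≤maxDegree maxDegree c v inject₁ inject₁-injective λ i → sees v (inject₁ i) (i<cv i))
  where
  i<cv : ∀ i → toℕ (inject₁ i) < toℕ (c v)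
  i<cv i = subst₂ _<_ (sym (toℕ-inject₁ i)) (sym (trans (cong toℕ cv≡last) (toℕ-fromℕ m))) (toℕ<n i)

-- Labelled trees

data LTree : Set where
  lnode : ℕ → List LTree → LTree

label : LTree → ℕ
label (lnode ℓ _) = ℓ

mutual
  shape : LTree → Tree
  shape (lnode _ ts) = node (shapes ts)

  shapes : List LTree → List Tree
  shapes []       = []
  shapes (t ∷ ts) = shape t ∷ shapes ts

shapes-∷ʳ : ∀ ts t → shapes (ts ∷ʳ t) ≡ shapes ts ∷ʳ shape t
shapes-∷ʳ []       t = refl
shapes-∷ʳ (s ∷ ts) t = cong (shape s ∷_) (shapes-∷ʳ ts t)

-- labelAt o T x is the label of vertex x when T is numbered in preorder from o, and 0 when
-- x is outside T.
mutual
  labelAt : ℕ → LTree → ℕ → ℕ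
  labelAt o (lnode ℓ ts) x with x ≟ o
  ... | yes _ = ℓ
  ... | no _  = labelsAt (suc o) ts x

  labelsAt : ℕ → List LTree → ℕ → ℕ
  labelsAt o []       x = 0
  labelsAt o (t ∷ ts) x with x <? o + size (shape t)
  ... | yes _ = labelAt o t x
  ... | no _  = labelsAt (o + size (shape t)) ts x

labelAt-root : ∀ o ℓ ts → labelAt o (lnode ℓ ts) o ≡ ℓ
labelAt-root o ℓ ts with o ≟ o
... | yes _   = refl
... | no o≢o = contradiction refl o≢o

labelAt-nonroot : ∀ o ℓ ts {x} → x ≢ o → labelAt o (lnode ℓ ts) x ≡ labelsAt (suc o) ts x
labelAt-nonroot o ℓ ts {x} x≢o with x ≟ o
... | yes x≡o = contradiction x≡o x≢o
... | no _    = refl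

labelsAt-head : ∀ o t ts {x} → x < o + size (shape t) → labelsAt o (t ∷ ts) x ≡ labelAt o t x
labelsAt-head o t ts {x} x<o+t with x <? o + size (shape t)
... | yes _     = refl
... | no x≮o+t = contradiction x<o+t x≮o+t

labelsAt-tail : ∀ o t ts {x} → o + size (shape t) ≤ x →
  labelsAt o (t ∷ ts) x ≡ labelsAt (o + size (shape t)) ts x
labelsAt-tail o t ts {x} o+t≤x with x <? o + size (shape t)
... | yes x<o+t = contradiction o+t≤x (<⇒≱ x<o+t)
... | no _      = refl

data AllLabels (P : ℕ → Set) : LTree → Set where
  lnode : ∀ {ℓ ts} → P ℓ → All (AllLabels P) ts → AllLabels P (lnode ℓ ts)

mutual
  labelAt-all : ∀ {P} → P 0 → ∀ o {T} → AllLabels P T → ∀ x → P (labelAt o T x)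
  labelAt-all P0 o {lnode ℓ ts} (lnode Pℓ Pts) x with x ≟ o
  ... | yes _ = Pℓ
  ... | no _  = labelsAt-all P0 (suc o) Pts x

  labelsAt-all : ∀ {P} → P 0 → ∀ o {ts} → All (AllLabels P) ts → ∀ x → P (labelsAt o ts x)
  labelsAt-all P0 o {[]}     []         x = P0
  labelsAt-all P0 o {t ∷ ts} (Pt ∷ Pts) x with x <? o + size (shape t)
  ... | yes _ = labelAt-all P0 o Pt x
  ... | no _  = labelsAt-all P0 (o + size (shape t)) Pts x

SomeRootLabelled : ℕ → List LTree → Set
SomeRootLabelled i = Any (λ t → label t ≡ i)

NeighbourInTree : ℕ → LTree → ℕ → ℕ → Set
NeighbourInTree o T x i =
  ∃ λ u → Adjacent (edges o (shape T)) x u × labelAt o T u ≡ i × u ∈[ o ,+ size (shape T) ⟩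

NeighbourInForest : ℕ → ℕ → List LTree → ℕ → ℕ → Set
NeighbourInForest p o ts x i =
  ∃ λ u → Adjacent (edgesL p o (shapes ts)) x u × labelsAt o ts u ≡ i × u ∈[ o ,+ sizes (shapes ts) ⟩

rootOfChild : ∀ p o ts {i} → SomeRootLabelled i ts → NeighbourInForest p o ts p i
rootOfChild p o (lnode ℓ ss ∷ ts) (here ℓ≡i) =
  o , inj₁ (here refl) ,
  trans (labelsAt-head o (lnode ℓ ss) ts (proj₂ o∈)) (trans (labelAt-root o ℓ ss) ℓ≡i) ,
  ∈[,+⟩-weakenʳ o∈
  where o∈ = root∈[,+⟩ o (shape (lnode ℓ ss))
rootOfChild p o (t ∷ ts) (there some) with rootOfChild p (o + size (shape t)) ts some
... | u , adj , lab , u∈ =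
  u , Adjacent-mono (edgesL-tail⊆edgesL p o (shape t) (shapes ts)) adj ,
  trans (labelsAt-tail o t ts (proj₁ u∈)) lab , ∈[,+⟩-shift u∈

forest⇒node : ∀ o ℓ ts {x i} → NeighbourInForest o (suc o) ts x i → NeighbourInTree o (lnode ℓ ts) x i
forest⇒node o ℓ ts (u , adj , lab , u∈) =
  u , adj , trans (labelAt-nonroot o ℓ ts (λ u≡o → 1+n≰n (≤-trans (proj₁ u∈) (≤-reflexive u≡o)))) lab ,
  ∈[,+⟩-suc u∈

tree⇒forest-head : ∀ p o t ts {x i} → NeighbourInTree o t x i → NeighbourInForest p o (t ∷ ts) x i
tree⇒forest-head p o t ts (u , adj , lab , u∈) =
  u , Adjacent-mono (edges⊆edgesL-head p o (shape t) (shapes ts)) adj ,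
  trans (labelsAt-head o t ts (proj₂ u∈)) lab , ∈[,+⟩-weakenʳ u∈

forest⇒forest-tail : ∀ p o t ts {x i} → NeighbourInForest p (o + size (shape t)) ts x i →
  NeighbourInForest p o (t ∷ ts) x i
forest⇒forest-tail p o t ts (u , adj , lab , u∈) =
  u , Adjacent-mono (edgesL-tail⊆edgesL p o (shape t) (shapes ts)) adj ,
  trans (labelsAt-tail o t ts (proj₁ u∈)) lab , ∈[,+⟩-shift u∈

-- Needs j i: a vertex of label j must have a neighbour of label i.  The first argument of
-- NeedsMet is the label of the parent, if any.
data NeedsMet (Needs : ℕ → ℕ → Set) : Maybe ℕ → LTree → Set where
  lnode : ∀ {parent ℓ ts} → (∀ i → Needs ℓ i → parent ≡ just i ⊎ SomeRootLabelled i ts) →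
    All (NeedsMet Needs (just ℓ)) ts → NeedsMet Needs parent (lnode ℓ ts)

module _ {Needs : ℕ → ℕ → Set} where
  mutual
    neighbourInTree : ∀ {parent} o T {x i} → NeedsMet Needs parent T → x ∈[ o ,+ size (shape T) ⟩ →
      Needs (labelAt o T x) i → NeighbourInTree o T x i ⊎ (x ≡ o × parent ≡ just i)
    neighbourInTree o (lnode ℓ ts) {x} {i} (lnode covered children) x∈ needs with x ≟ o
    ... | yes refl with covered i needs
    ...   | inj₁ parent≡i = inj₂ (refl , parent≡i)
    ...   | inj₂ some     = inj₁ (forest⇒node o ℓ ts (rootOfChild o (suc o) ts some))
    neighbourInTree o (lnode ℓ ts) (lnode _ children) x∈ needs | no x≢o
      with neighbourInForest o ℓ (suc o) ts children (∈[,+⟩-unsuc x≢o x∈) needs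
    ...   | inj₁ below        = inj₁ (forest⇒node o ℓ ts below)
    ...   | inj₂ (ℓ≡i , adj) =
      inj₁ (o , adj , trans (labelAt-root o ℓ ts) ℓ≡i , root∈[,+⟩ o (shape (lnode ℓ ts)))

    neighbourInForest : ∀ p ℓ o ts {x i} → All (NeedsMet Needs (just ℓ)) ts → x ∈[ o ,+ sizes (shapes ts) ⟩ →
      Needs (labelsAt o ts x) i →
      NeighbourInForest p o ts x i ⊎ (ℓ ≡ i × Adjacent (edgesL p o (shapes ts)) x p)
    neighbourInForest p ℓ o []       []             x∈ _     = contradiction x∈ ∉[,+0⟩
    neighbourInForest p ℓ o (t ∷ ts) {x} (met ∷ mets) x∈ needs with x <? o + size (shape t)
    ... | yes x<o+t with neighbourInTree o t met (proj₁ x∈ , x<o+t) needs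
    ...   | inj₁ inside         = inj₁ (tree⇒forest-head p o t ts inside)
    ...   | inj₂ (refl , refl) = inj₂ (refl , inj₂ (here refl))
    neighbourInForest p ℓ o (t ∷ ts) (met ∷ mets) x∈ needs | no x≮o+t
      with neighbourInForest p ℓ (o + size (shape t)) ts mets (∈[,+⟩-unshift (≮⇒≥ x≮o+t) x∈) needs
    ...   | inj₁ further      = inj₁ (forest⇒forest-tail p o t ts further)
    ...   | inj₂ (ℓ≡i , adj) =
      inj₂ (ℓ≡i , Adjacent-mono (edgesL-tail⊆edgesL p o (shape t) (shapes ts)) adj)

-- Transitive partitions (Needs j i = i < j) and total ones (Needs j i = i ≤ j) at once.
HasPartition : (ℕ → ℕ → Set) → Graph → ℕ → Set
HasPartition Needs G k = ∃ λ (c : Fin (n G) → Fin k) →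
  ((i : Fin k) → ∃ λ v → c v ≡ i) ×
  (∀ v i → Needs (toℕ (c v)) (toℕ i) → ∃ λ u → Adj G v u × c u ≡ i)

labelled⇒partition : ∀ {Needs K} T → AllLabels (_< K) T → NeedsMet Needs nothing T →
  ((i : Fin K) → toℕ i ≡ label T ⊎ Needs (label T) (toℕ i)) → HasPartition Needs (treeGraph (shape T)) K
labelled⇒partition {Needs} {K} T@(lnode ℓ ts) labels<K@(lnode ℓ<K _) met rootSeesAll = c , nonempty , sees
  where
  c : Fin (size (shape T)) → Fin K
  c v = fromℕ< (labelAt-all (≤-trans z<s ℓ<K) 0 labels<K (toℕ v))

  toℕ-c : ∀ v → toℕ (c v) ≡ labelAt 0 T (toℕ v)
  toℕ-c v = toℕ-fromℕ< _

  sees : ∀ v i → Needs (toℕ (c v)) (toℕ i) → ∃ λ u → Adj (treeGraph (shape T)) v u × c u ≡ i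
  sees v i needs
    with neighbourInTree 0 T met (z≤n , toℕ<n v) (subst (λ j → Needs j (toℕ i)) (toℕ-c v) needs)
  ... | inj₂ (_ , ())
  ... | inj₁ (u , adj , lab , (_ , u<size)) =
    fromℕ< u<size ,
    subst (Adjacent (edges 0 (shape T)) (toℕ v)) (sym (toℕ-fromℕ< u<size)) adj ,
    toℕ-injective (trans (toℕ-c (fromℕ< u<size)) (trans (cong (labelAt 0 T) (toℕ-fromℕ< u<size)) lab))

  c-root : toℕ (c Fin.zero) ≡ ℓ
  c-root = trans (toℕ-c Fin.zero) (labelAt-root 0 ℓ ts)

  nonempty : ∀ i → ∃ λ v → c v ≡ i
  nonempty i with rootSeesAll i
  ... | inj₁ i≡ℓ   = Fin.zero , toℕ-injective (trans c-root (sym i≡ℓ))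
  ... | inj₂ needs with sees Fin.zero i (subst (λ j → Needs j (toℕ i)) (sym c-root) needs)
  ...   | u , _ , cu≡i = u , cu≡i

-- The two labellings of tcmbt

-- coloured (suc k) labels tcmbt (suc k): the root of every copy of tcmbt (suc j) gets
-- rootLabel j and every vertex v_(j+1) gets midLabel j.
module Coloured (rootLabel midLabel : ℕ → ℕ) where
  mutual
    coloured : ℕ → LTree
    coloured zero    = lnode 0 []
    coloured (suc k) = lnode (rootLabel k) (colouredBelow k ∷ʳ lnode (midLabel k) (colouredBelow k))

    colouredBelow : ℕ → List LTree
    colouredBelow zero    = []
    colouredBelow (suc k) = colouredBelow k ∷ʳ coloured (suc k)

  mutual
    shape-coloured : ∀ k → shape (coloured k) ≡ tcmbt k
    shape-coloured zero    = refl
    shape-coloured (suc k) = cong node (begin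
      shapes (colouredBelow k ∷ʳ lnode (midLabel k) (colouredBelow k))
        ≡⟨ shapes-∷ʳ (colouredBelow k) _ ⟩
      shapes (colouredBelow k) ∷ʳ node (shapes (colouredBelow k))
        ≡⟨ cong (λ ts → ts ∷ʳ node ts) (shapes-colouredBelow k) ⟩
      below k ∷ʳ node (below k) ∎)
      where open ≡-Reasoning

    shapes-colouredBelow : ∀ k → shapes (colouredBelow k) ≡ below k
    shapes-colouredBelow zero    = refl
    shapes-colouredBelow (suc k) =
      trans (shapes-∷ʳ (colouredBelow k) _) (cong₂ _∷ʳ_ (shapes-colouredBelow k) (shape-coloured (suc k)))

  colouredBelow-roots : ∀ {j k} → j < k → SomeRootLabelled (rootLabel j) (colouredBelow k)
  colouredBelow-roots {j} {suc k} j<1+k with m≤n⇒m<n∨m≡n (s≤s⁻¹ j<1+k)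
  ... | inj₁ j<k  = ++⁺ˡ (colouredBelow-roots j<k)
  ... | inj₂ refl = ++⁺ʳ (colouredBelow j) (here refl)

  module _ {P : ℕ → Set} where
    mutual
      coloured-allLabels : ∀ k → (∀ {j} → j ≤ k → P (rootLabel j) × P (midLabel j)) →
        AllLabels P (coloured (suc k))
      coloured-allLabels k P≤k =
        lnode (proj₁ (P≤k ≤-refl))
          (All-++⁺ (colouredBelow-allLabels k (P≤k ∘ <⇒≤))
                   (lnode (proj₂ (P≤k ≤-refl)) (colouredBelow-allLabels k (P≤k ∘ <⇒≤)) ∷ []))

      colouredBelow-allLabels : ∀ k → (∀ {j} → j < k → P (rootLabel j) × P (midLabel j)) →
        All (AllLabels P) (colouredBelow k)
      colouredBelow-allLabels zero    _     = []
      colouredBelow-allLabels (suc k) P<1+k =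
        All-++⁺ (colouredBelow-allLabels k (P<1+k ∘ m<n⇒m<1+n)) (coloured-allLabels k (P<1+k ∘ s≤s) ∷ [])

  module _ {Needs : ℕ → ℕ → Set}
    (rootNeeds : ∀ {k i} → Needs (rootLabel k) i → i ≡ midLabel k ⊎ ∃ λ j → j < k × rootLabel j ≡ i)
    (midNeeds : ∀ {k i} → Needs (midLabel k) i → i ≡ rootLabel k ⊎ ∃ λ j → j < k × rootLabel j ≡ i)
    where
    mutual
      coloured-needsMet : ∀ parent k → NeedsMet Needs parent (coloured (suc k))
      coloured-needsMet parent k =
        lnode rootCovered
          (All-++⁺ (colouredBelow-needsMet (rootLabel k) k)
                   (lnode midCovered (colouredBelow-needsMet (midLabel k) k) ∷ []))
        where
        rootCovered : ∀ i → Needs (rootLabel k) i →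
          parent ≡ just i ⊎ SomeRootLabelled i (colouredBelow k ∷ʳ lnode (midLabel k) (colouredBelow k))
        rootCovered i needs with rootNeeds needs
        ... | inj₁ refl              = inj₂ (++⁺ʳ (colouredBelow k) (here refl))
        ... | inj₂ (j , j<k , refl) = inj₂ (++⁺ˡ (colouredBelow-roots j<k))

        midCovered : ∀ i → Needs (midLabel k) i →
          just (rootLabel k) ≡ just i ⊎ SomeRootLabelled i (colouredBelow k)
        midCovered i needs with midNeeds needs
        ... | inj₁ refl              = inj₁ refl
        ... | inj₂ (j , j<k , refl) = inj₂ (colouredBelow-roots j<k)

      colouredBelow-needsMet : ∀ parent k → All (NeedsMet Needs (just parent)) (colouredBelow k)
      colouredBelow-needsMet parent zero    = []
      colouredBelow-needsMet parent (suc k) =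
        All-++⁺ (colouredBelow-needsMet parent k) (coloured-needsMet (just parent) k ∷ [])

tcmbt-totalPartition : ∀ k → HasTotalTransitivePartition (treeGraph (tcmbt (suc k))) (suc k)
tcmbt-totalPartition k =
  subst (λ t → HasPartition (λ j i → i ≤ j) (treeGraph t) (suc k)) (shape-coloured (suc k))
    (labelled⇒partition (coloured (suc k))
      (coloured-allLabels k λ j≤k → s≤s j≤k , s≤s j≤k)
      (coloured-needsMet {Needs = λ j i → i ≤ j} lowerOrEqual lowerOrEqual nothing k)
      (λ i → inj₂ (toℕ≤pred[n] i)))
  where
  open Coloured id id
  lowerOrEqual : ∀ {k i} → i ≤ k → i ≡ k ⊎ ∃ λ j → j < k × j ≡ i
  lowerOrEqual i≤k = Sum.swap (Sum.map₁ (λ i<k → _ , i<k , refl) (m≤n⇒m<n∨m≡n i≤k))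

tcmbt-transitivePartition : ∀ k → HasTransitivePartition (treeGraph (tcmbt (suc k))) (suc (suc k))
tcmbt-transitivePartition k =
  subst (λ t → HasPartition (λ j i → i < j) (treeGraph t) (suc (suc k))) (shape-coloured (suc k))
    (labelled⇒partition (coloured (suc k))
      (coloured-allLabels k λ j≤k → s≤s (s≤s j≤k) , z<s)
      (coloured-needsMet {Needs = λ j i → i < j} zeroOrSuc (λ ()) nothing k)
      (λ i → Sum.swap (m≤n⇒m<n∨m≡n (toℕ≤pred[n] i))))
  where
  open Coloured suc (λ _ → 0)
  zeroOrSuc : ∀ {k i} → i < suc k → i ≡ 0 ⊎ ∃ λ j → j < k × suc j ≡ i
  zeroOrSuc {i = zero}  _       = inj₁ refl
  zeroOrSuc {i = suc j} j+1<k+1 = inj₂ (j , s≤s⁻¹ j+1<k+1 , refl)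

lemma2 : (k : ℕ) → 1 ≤ k →
    TrtEq (treeGraph (tcmbt k)) k × TrEq (treeGraph (tcmbt k)) (suc k)
lemma2 (suc k) _ =
  (tcmbt-totalPartition k , totalTransitive≤maxDegree (tcmbt-maxDegree≤ k)) ,
  (tcmbt-transitivePartition k , transitive≤1+maxDegree (tcmbt-maxDegree≤ k))
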